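{- Let $k\in\mathbb{N}$ with $6\mid k$ and let $h$ be an integer with $\gcd(h,k)=1$. Then \[ \frac{\omega_{h,k}\,\omega_{h,\frac k2}\,\omega_{h,\frac k3}}{\omega_{h,\frac k6}} = -e^{\pi i\frac{5k+18}{36}h}. \]
   Context: For integers $a,c$ with $c\ge1$ and $\gcd(a,c)=1$, let $a'$ be any integer with $aa'\equiv-1\pmod c$ and set \[ \omega_{a,c} := \begin{cases} \left(\frac{ -c}{a}\right)e^{ -\pi i\left(\frac14(2-ac-a)+\frac{1}{12}\left(c-\frac1c\right)\left(2a-a'+a^2a'\right)\right)} & \text{if }a\text{ is odd},\\ \left(\frac{ -a}{c}\right)e^{ -\pi i\left(\frac14(c-1)+\frac{1}{12}\left(c-\frac1c\right)\left(2a-a'+a^2a'\right)\right)} & \text{if }c\text{ is odd}, \end{cases} \] where $\left(\frac{\cdot}{\cdot}\right)$ is the Kronecker symbol; $\omega_{a,c}$ depends only on $a\bmod c$. -}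

module Defs where

open import Data.Nat as ℕ using (ℕ; zero; suc)
open import Data.Nat.DivMod as ℕD using ()
open import Data.Integer as ℤ using (ℤ; +_; -[1+_]; ∣_∣)
open import Data.Integer.DivMod using (_%ℕ_)
open import Data.Integer.Divisibility as ℤDiv using ()
open import Data.Rational as ℚ using (ℚ; _/_)
open import Data.Bool using (Bool; true; false; if_then_else_)
open import Data.Product using (∃)
open import Relation.Binary.PropositionalEquality using (_≡_)
open import Relation.Nullary.Decidable using (does; yes; no)

legendre : ℤ → ℕ → ℤ
legendre n zero = + 0
legendre n p@(suc _) with (n %ℕ p) ℕ.^ ((p ℕ.∸ 1) ℕ./ 2) ℕ.% p
... | zero = + 0
... | suc zero = + 1
... | suc (suc _) = ℤ.- (+ 1)

kron2 : ℤ → ℤ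
kron2 n with n %ℕ 8
... | 1 = + 1
... | 7 = + 1
... | 3 = ℤ.- (+ 1)
... | 5 = ℤ.- (+ 1)
... | _ = + 0

kronPrime : ℤ → ℕ → ℤ
kronPrime n p = if does (p ℕ.≟ 2) then kron2 n else legendre n p

leastDivFrom : ℕ → ℕ → ℕ → ℕ
leastDivFrom zero d m = m
leastDivFrom (suc f) zero m = leastDivFrom f 1 m
leastDivFrom (suc f) d@(suc _) m =
  if does (m ℕ.% d ℕ.≟ 0) then d else leastDivFrom f (suc d) m

lpf : ℕ → ℕ
lpf m = leastDivFrom m 2 m

kronPos : ℕ → ℤ → ℕ → ℤ
kronPos zero n m = + 1
kronPos (suc f) n m with m ℕ.≤? 1
... | yes _ = + 1
... | no _ with lpf m
...   | zero = + 1
...   | p@(suc _) = kronPrime n p ℤ.* kronPos f n (m ℕ./ p)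

kronecker : ℤ → ℤ → ℤ
kronecker n (+ zero) = if does (∣ n ∣ ℕ.≟ 1) then + 1 else + 0
kronecker n (+ m@(suc _)) = kronPos m n m
kronecker n m@(-[1+ _ ]) =
  (if does (n ℤ.<? + 0) then ℤ.- (+ 1) else + 1) ℤ.* kronPos (∣ m ∣) n (∣ m ∣)

-- Roots of unity are represented by their "angle" r ∈ ℚ, standing for
-- e^{π i r}; two angles give the same complex number iff they agree mod 2.

_≡[mod2]_ : ℚ → ℚ → Set
x ≡[mod2] y = ∃ λ (n : ℤ) → x ℚ.- y ≡ (n ℤ.* + 2) / 1

signAngle : ℤ → ℚ
signAngle ε = if does (ε ℤ.≟ ℤ.- (+ 1)) then ℚ.1ℚ else ℚ.0ℚ

ℤ→ℚ : ℤ → ℚ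
ℤ→ℚ z = z / 1

ℕ→ℚ : ℕ → ℚ
ℕ→ℚ n = + n / 1

inv : ℕ → ℚ
inv zero = ℚ.0ℚ
inv n@(suc _) = + 1 / n

isOdd : ℤ → Bool
isOdd a = does (∣ a ∣ ℕ.% 2 ℕ.≟ 1)

-- angle of ω_{a,c}, given a' with a a' ≡ -1 (mod c):
-- ω_{a,c} = e^{π i · ωAngle a c a'}
ωAngle : ℤ → ℕ → ℤ → ℚ
ωAngle a c a' =
  if isOdd a
  then signAngle (kronecker (ℤ.- (+ c)) a)
       ℚ.- (+ 1 / 4) ℚ.* ℤ→ℚ (+ 2 ℤ.- a ℤ.* + c ℤ.- a)
       ℚ.- common
  else signAngle (kronecker (ℤ.- a) (+ c))
       ℚ.- (+ 1 / 4) ℚ.* ℤ→ℚ (+ c ℤ.- + 1)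
       ℚ.- common
  where
  common : ℚ
  common = (+ 1 / 12) ℚ.* (ℕ→ℚ c ℚ.- inv c)
           ℚ.* ℤ→ℚ (+ 2 ℤ.* a ℤ.- a' ℤ.+ a ℤ.* a ℤ.* a')

IsNegInv : ℤ → ℕ → ℤ → Set
IsNegInv a c a' = (+ c) ℤDiv.∣ (a ℤ.* a' ℤ.+ + 1)

-- Write k = 6M. As h is prime to 6 it is odd and h² = 24q + 1, so the term h²a′ in an ω-angle
-- becomes a′ + 24qa′. Summing the four angles with signs +, +, +, −, the terms in hc add up to
-- (5k + 18)h/36 − 1, and the terms in 1/c combine to 2q(h₁ + 2h₂ + 3h₃ − 6h₆)/(6M) = 2qt with t an
-- integer: h(h₁ + 2h₂ + 3h₃ − 6h₆) is a combination of the hhᵢ + 1, hence divisible by 6M, and h is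
-- prime to 6M. What is left besides even integers is the sum of the four Kronecker sign angles, which
-- is even because (−6M/h)(−3M/h)(−2M/h)(−M/h) = ((6M²)²/h) = 1. Multiplicativity of the Legendre
-- symbol, defined by Euler's criterion, follows from Fermat's little theorem, itself a consequence of
-- the binomial theorem.

module Submission where

open import Defs
open import Relation.Binary.PropositionalEquality using (_≡_; refl)

cong₃ : ∀ {A B C D : Set} (f : A → B → C → D) {x x′ y y′ z z′} →
  x ≡ x′ → y ≡ y′ → z ≡ z′ → f x y z ≡ f x′ y′ z′
cong₃ f refl refl refl = refl

module Binomial where

  open import Data.Nat
  open import Data.Nat.Properties
  open import Data.Nat.Divisibility
  open import Data.Nat.Primality using (Prime; euclidsLemma)
  open import Data.Nat.Combinatorics using (_C_; nCn≡1; nC1≡n; k>n⇒nCk≡0; nCk+nC[k+1]≡[n+1]C[k+1])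
  open import Data.Nat.Tactic.RingSolver using (solve-∀)
  open import Data.Product using (∃; _,_)
  open import Data.Sum using (inj₁; inj₂)
  open import Function using (_∘_)
  open import Relation.Binary.PropositionalEquality
  open import Relation.Nullary using (contradiction)

  sumBelow : ℕ → (ℕ → ℕ) → ℕ
  sumBelow zero    f = 0
  sumBelow (suc n) f = f 0 + sumBelow n (f ∘ suc)

  sumBelow-cong : ∀ {f g} n → (∀ i → f i ≡ g i) → sumBelow n f ≡ sumBelow n g
  sumBelow-cong zero    f≗g = refl
  sumBelow-cong (suc n) f≗g = cong₂ _+_ (f≗g 0) (sumBelow-cong n (f≗g ∘ suc))

  sumBelow-distrib-+ : ∀ f g n → sumBelow n (λ i → f i + g i) ≡ sumBelow n f + sumBelow n g
  sumBelow-distrib-+ f g zero    = refl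
  sumBelow-distrib-+ f g (suc n) = begin
    f 0 + g 0 + sumBelow n (λ i → f (suc i) + g (suc i))
      ≡⟨ cong (_+_ (f 0 + g 0)) (sumBelow-distrib-+ (f ∘ suc) (g ∘ suc) n) ⟩
    f 0 + g 0 + (sumBelow n (f ∘ suc) + sumBelow n (g ∘ suc))
      ≡⟨ +-assoc-interchange (f 0) (g 0) _ _ ⟩
    f 0 + sumBelow n (f ∘ suc) + (g 0 + sumBelow n (g ∘ suc)) ∎
    where
    open ≡-Reasoning
    +-assoc-interchange : ∀ a b c d → a + b + (c + d) ≡ a + c + (b + d)
    +-assoc-interchange = solve-∀

  sumBelow-*ˡ : ∀ c f n → sumBelow n (λ i → c * f i) ≡ c * sumBelow n f
  sumBelow-*ˡ c f zero    = sym (*-zeroʳ c)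
  sumBelow-*ˡ c f (suc n) = trans (cong (_+_ (c * f 0)) (sumBelow-*ˡ c (f ∘ suc) n))
                                  (sym (*-distribˡ-+ c (f 0) _))

  sumBelow-last : ∀ f n → sumBelow (suc n) f ≡ sumBelow n f + f n
  sumBelow-last f zero    = +-comm (f 0) 0
  sumBelow-last f (suc n) = trans (cong (_+_ (f 0)) (sumBelow-last (f ∘ suc) n))
                                  (sym (+-assoc (f 0) _ _))

  ∣-sumBelow : ∀ {d} f n → (∀ i → i < n → d ∣ f i) → d ∣ sumBelow n f
  ∣-sumBelow f zero    d∣f = _ ∣0
  ∣-sumBelow f (suc n) d∣f =
    ∣m∣n⇒∣m+n (d∣f 0 z<s) (∣-sumBelow (f ∘ suc) n (λ i i<n → d∣f (suc i) (s<s i<n)))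

  binomial-theorem : ∀ n a → (1 + a) ^ n ≡ sumBelow (suc n) (λ i → (n C i) * a ^ i)
  binomial-theorem zero    a = refl
  binomial-theorem (suc n) a = begin
    (1 + a) * (1 + a) ^ n               ≡⟨ cong ((1 + a) *_) (binomial-theorem n a) ⟩
    (1 + a) * (1 + T)                   ≡⟨ expand a T ⟩
    1 + (a * (1 + T) + (T + 0))         ≡⟨ cong (λ z → 1 + (a * (1 + T) + (T + z * a ^ suc n)))
                                              (sym (k>n⇒nCk≡0 (n<1+n n))) ⟩
    1 + (a * S + (T + (n C suc n) * a ^ suc n))
                                        ≡⟨ cong (λ z → 1 + (a * S + z)) (sym (sumBelow-last shifted n)) ⟩
    1 + (a * S + sumBelow (suc n) shifted)
                                        ≡⟨ cong (λ z → 1 + (z + sumBelow (suc n) shifted)) (sym (sumBelow-*ˡ a term (suc n))) ⟩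
    1 + (sumBelow (suc n) (λ i → a * term i) + sumBelow (suc n) shifted)
                                        ≡⟨ cong (_+_ 1) (sym (sumBelow-distrib-+ (λ i → a * term i) shifted (suc n))) ⟩
    1 + sumBelow (suc n) (λ i → a * term i + shifted i)
                                        ≡⟨ cong (_+_ 1) (sumBelow-cong (suc n) pascal) ⟩
    1 + sumBelow (suc n) (λ i → (suc n C suc i) * a ^ suc i) ∎
    where
    open ≡-Reasoning
    term shifted : ℕ → ℕ
    term i = (n C i) * a ^ i
    shifted i = (n C suc i) * a ^ suc i
    S = sumBelow (suc n) term
    T = sumBelow n shifted
    expand : ∀ a T → (1 + a) * (1 + T) ≡ 1 + (a * (1 + T) + (T + 0))
    expand = solve-∀
    pascal : ∀ i → a * term i + shifted i ≡ (suc n C suc i) * a ^ suc i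
    pascal i = trans (regroup (n C i) (n C suc i) a (a ^ i))
                     (cong (_* a ^ suc i) (nCk+nC[k+1]≡[n+1]C[k+1] n i))
      where
      regroup : ∀ x y a b → a * (x * b) + y * (a * b) ≡ (x + y) * (a * b)
      regroup = solve-∀

  [k+1]*[n+1]C[k+1]≡[n+1]*nCk : ∀ n k → suc k * (suc n C suc k) ≡ suc n * (n C k)
  [k+1]*[n+1]C[k+1]≡[n+1]*nCk n       zero    = trans (*-identityˡ _) (trans (nC1≡n (suc n)) (sym (*-identityʳ (suc n))))
  [k+1]*[n+1]C[k+1]≡[n+1]*nCk zero    (suc k) = *-zeroʳ (suc (suc k))
  [k+1]*[n+1]C[k+1]≡[n+1]*nCk (suc n) (suc k) = begin
    (2 + k) * (suc (suc n) C suc (suc k))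
                                    ≡⟨ cong ((2 + k) *_) (sym (nCk+nC[k+1]≡[n+1]C[k+1] (suc n) (suc k))) ⟩
    (2 + k) * (X + Y)               ≡⟨ split k X Y ⟩
    X + suc k * X + (2 + k) * Y     ≡⟨ cong₂ (λ u v → X + u + v) ([k+1]*[n+1]C[k+1]≡[n+1]*nCk n k)
                                                                 ([k+1]*[n+1]C[k+1]≡[n+1]*nCk n (suc k)) ⟩
    X + suc n * A + suc n * B       ≡⟨ cong (λ z → z + suc n * A + suc n * B) (sym (nCk+nC[k+1]≡[n+1]C[k+1] n k)) ⟩
    A + B + suc n * A + suc n * B   ≡⟨ merge n A B ⟩
    (2 + n) * (A + B)               ≡⟨ cong ((2 + n) *_) (nCk+nC[k+1]≡[n+1]C[k+1] n k) ⟩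
    (2 + n) * X                     ∎
    where
    open ≡-Reasoning
    A = n C k
    B = n C suc k
    X = suc n C suc k
    Y = suc n C suc (suc k)
    split : ∀ k x y → (2 + k) * (x + y) ≡ x + suc k * x + (2 + k) * y
    split = solve-∀
    merge : ∀ n a b → a + b + suc n * a + suc n * b ≡ (2 + n) * (a + b)
    merge = solve-∀

  p∣pC[k+1] : ∀ {n k} → Prime (suc n) → k < n → suc n ∣ suc n C suc k
  p∣pC[k+1] {n} {k} p-prime k<n
    with euclidsLemma (suc k) (suc n C suc k) p-prime
           (subst (suc n ∣_) (sym ([k+1]*[n+1]C[k+1]≡[n+1]*nCk n k)) (m∣m*n (n C k)))
  ... | inj₁ p∣1+k = contradiction (∣⇒≤ p∣1+k) (<⇒≱ (s<s k<n))
  ... | inj₂ p∣pCk = p∣pCk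

  fermat-ℕ : ∀ {n} → Prime (suc n) → ∀ a → ∃ λ q → a ^ suc n ≡ a + q * suc n
  fermat-ℕ {n} p-prime zero    = 0 , refl
  fermat-ℕ {n} p-prime (suc a) =
    step (fermat-ℕ p-prime a) (∣-sumBelow inner n (λ i i<n → ∣m⇒∣m*n (a ^ suc i) (p∣pC[k+1] p-prime i<n)))
    where
    open ≡-Reasoning
    p = suc n
    inner : ℕ → ℕ
    inner i = (p C suc i) * a ^ suc i
    collect : ∀ w p a q → 1 + (w * p + 1 * (a + q * p)) ≡ suc a + (w + q) * p
    collect = solve-∀
    step : ∃ (λ q → a ^ p ≡ a + q * p) → p ∣ sumBelow n inner → ∃ λ q → (1 + a) ^ p ≡ suc a + q * p
    step (q , aᵖ≡) (divides w inner≡) = w + q , (begin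
      (1 + a) ^ p                                 ≡⟨ binomial-theorem p a ⟩
      1 + sumBelow p inner                        ≡⟨ cong (_+_ 1) (sumBelow-last inner n) ⟩
      1 + (sumBelow n inner + (p C p) * a ^ p)    ≡⟨ cong₂ (λ u v → 1 + (u + v * a ^ p)) inner≡ (nCn≡1 p) ⟩
      1 + (w * p + 1 * a ^ p)                     ≡⟨ cong (λ z → 1 + (w * p + 1 * z)) aᵖ≡ ⟩
      1 + (w * p + 1 * (a + q * p))               ≡⟨ collect w p a q ⟩
      suc a + (w + q) * p                         ∎)

module Congruence where

  open import Data.Nat as ℕ using (ℕ; zero; suc)
  open import Data.Nat.Divisibility as ℕ using ()
  open import Data.Nat.Primality using (Prime; euclidsLemma)
  open import Data.Integer hiding (suc)
  import Data.Integer.Properties as ℤP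
  open import Data.Integer.DivMod using (a≡a%ℕn+[a/ℕn]*n)
  open import Data.Integer.Divisibility.Signed
    using (_∣_; divides; ∣ᵤ⇒∣; ∣⇒∣ᵤ; ∣m⇒∣-m; ∣m∣n⇒∣m+n; ∣n⇒∣m*n; ∣m⇒∣m*n)
  open import Data.Integer.Tactic.RingSolver using (solve-∀)
  open import Data.Product using (_,_)
  open import Data.Sum using (_⊎_; inj₁; inj₂; [_,_]′)
  open import Relation.Binary.Bundles using (Setoid)
  import Relation.Binary.Reasoning.Setoid as SetoidReasoning
  open import Relation.Binary.PropositionalEquality
  open import Relation.Nullary using (¬_; contradiction)
  open Binomial using (fermat-ℕ)

  infix 4 _≡_mod_
  record _≡_mod_ (x y : ℤ) (n : ℕ) : Set where
    constructor congruence
    field divides-difference : + n ∣ x - y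
  open _≡_mod_

  module _ {n : ℕ} where

    ≡⇒≡-mod : ∀ {x y} → x ≡ y → x ≡ y mod n
    ≡⇒≡-mod {x} refl = congruence (divides (+ 0) (ℤP.+-inverseʳ x))

    ≡-mod-sym : ∀ {x y} → x ≡ y mod n → y ≡ x mod n
    ≡-mod-sym {x} {y} (congruence n∣x-y) = congruence (subst (+ n ∣_) (negate x y) (∣m⇒∣-m n∣x-y))
      where negate : ∀ x y → - (x - y) ≡ y - x
            negate = solve-∀

    ≡-mod-trans : ∀ {x y z} → x ≡ y mod n → y ≡ z mod n → x ≡ z mod n
    ≡-mod-trans {x} {y} {z} (congruence n∣x-y) (congruence n∣y-z) =
      congruence (subst (+ n ∣_) (telescope x y z) (∣m∣n⇒∣m+n n∣x-y n∣y-z))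
      where telescope : ∀ x y z → (x - y) + (y - z) ≡ x - z
            telescope = solve-∀

    *-cong-mod : ∀ {x y u v} → x ≡ y mod n → u ≡ v mod n → x * u ≡ y * v mod n
    *-cong-mod {x} {y} {u} {v} (congruence n∣x-y) (congruence n∣u-v) =
      congruence (subst (+ n ∣_) (regroup x y u v) (∣m∣n⇒∣m+n (∣m⇒∣m*n u n∣x-y) (∣n⇒∣m*n y n∣u-v)))
      where regroup : ∀ x y u v → (x - y) * u + y * (u - v) ≡ x * u - y * v
            regroup = solve-∀

    ^-cong-mod : ∀ {x y} k → x ≡ y mod n → x ^ k ≡ y ^ k mod n
    ^-cong-mod zero    x≡y = ≡⇒≡-mod refl
    ^-cong-mod (suc k) x≡y = *-cong-mod x≡y (^-cong-mod k x≡y)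

    +-multiple-mod : ∀ x q → x + q * + n ≡ x mod n
    +-multiple-mod x q = congruence (divides q (cancel x q (+ n)))
      where cancel : ∀ x q n → (x + q * n) - x ≡ q * n
            cancel = solve-∀

  ≡-mod-%ℕ : ∀ x n .{{_ : ℕ.NonZero n}} → x ≡ + (x %ℕ n) mod n
  ≡-mod-%ℕ x n = subst (_≡ + (x %ℕ n) mod n) (sym (a≡a%ℕn+[a/ℕn]*n x n))
                       (+-multiple-mod (+ (x %ℕ n)) (x /ℕ n))

  pos-^ : ∀ a k → + (a ℕ.^ k) ≡ (+ a) ^ k
  pos-^ a zero    = refl
  pos-^ a (suc k) = trans (ℤP.pos-* a (a ℕ.^ k)) (cong (+ a *_) (pos-^ a k))

  ^-distribʳ-* : ∀ x y k → (x * y) ^ k ≡ x ^ k * y ^ k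
  ^-distribʳ-* x y zero    = refl
  ^-distribʳ-* x y (suc k) = trans (cong (x * y *_) (^-distribʳ-* x y k)) (interchange x y (x ^ k) (y ^ k))
    where interchange : ∀ x y u v → x * y * (u * v) ≡ x * u * (y * v)
          interchange = solve-∀

  ≡-mod-setoid : ℕ → Setoid _ _
  ≡-mod-setoid n = record
    { Carrier = ℤ
    ; _≈_ = λ x y → x ≡ y mod n
    ; isEquivalence = record { refl = ≡⇒≡-mod refl ; sym = ≡-mod-sym ; trans = ≡-mod-trans }
    }

  module ≡-mod-Reasoning (n : ℕ) = SetoidReasoning (≡-mod-setoid n)

  euclidsLemma-ℤ : ∀ x y {p} → Prime p → (+ p ∣ x * y) → (+ p ∣ x) ⊎ (+ p ∣ y)
  euclidsLemma-ℤ x y p-prime p∣xy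
    with euclidsLemma ∣ x ∣ ∣ y ∣ p-prime (subst (ℕ._∣_ _) (ℤP.abs-* x y) (∣⇒∣ᵤ p∣xy))
  ... | inj₁ p∣x = inj₁ (∣ᵤ⇒∣ p∣x)
  ... | inj₂ p∣y = inj₂ (∣ᵤ⇒∣ p∣y)

  fermat-ℤ : ∀ {n} → Prime (suc n) → ∀ x → x ^ suc n ≡ x mod suc n
  fermat-ℤ {n} p-prime x with fermat-ℕ p-prime (x %ℕ suc n)
  ... | q , rᵖ≡r+qp = begin
    x ^ p               ≈⟨ ^-cong-mod p (≡-mod-%ℕ x p) ⟩
    (+ r) ^ p           ≡⟨ sym (pos-^ r p) ⟩
    + (r ℕ.^ p)         ≡⟨ cong +_ rᵖ≡r+qp ⟩
    + (r ℕ.+ q ℕ.* p)   ≡⟨ trans (ℤP.pos-+ r (q ℕ.* p)) (cong (_+_ (+ r)) (ℤP.pos-* q p)) ⟩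
    + r + + q * + p     ≈⟨ +-multiple-mod (+ r) (+ q) ⟩
    + r                 ≈⟨ ≡-mod-sym (≡-mod-%ℕ x p) ⟩
    x                   ∎
    where
    p = suc n
    r = x %ℕ p
    open ≡-mod-Reasoning p

  fermat-little : ∀ {n} → Prime (suc n) → ∀ {x} → ¬ (+ suc n ∣ x) → x ^ n ≡ 1ℤ mod suc n
  fermat-little {n} p-prime {x} p∤x =
    [ (λ p∣x → contradiction p∣x p∤x) , congruence ]′
    (euclidsLemma-ℤ x (x ^ n - 1ℤ) p-prime
      (subst (+ suc n ∣_) (factor x (x ^ n)) (divides-difference (fermat-ℤ p-prime x))))
    where
    factor : ∀ x y → x * y - x ≡ x * (y - 1ℤ)
    factor = solve-∀

module Legendre where

  open import Data.Nat as ℕ using (ℕ; zero; suc)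
  import Data.Nat.Properties as ℕP
  open import Data.Nat.DivMod using (m≡m%n+[m/n]*n; m%n<n)
  open import Data.Nat.Divisibility as ℕ using ()
  open import Data.Nat.Primality using (Prime; prime; composite-≢)
  open import Data.Integer hiding (suc)
  import Data.Integer.Properties as ℤP
  open import Data.Integer.Divisibility.Signed using (_∣_; ∣⇒∣ᵤ; ∣m⇒∣-m)
  open import Data.Integer.Tactic.RingSolver using (solve-∀)
  open import Data.Product using (_×_; _,_; proj₁; proj₂; map₂)
  open import Data.Sum using (_⊎_; inj₁; inj₂; [_,_]′)
  open import Function using (_∘_)
  open import Relation.Binary.PropositionalEquality
  open import Relation.Nullary using (¬_; contradiction)
  open Congruence

  IsSign : ℤ → Set
  IsSign x = x ≡ 1ℤ ⊎ x ≡ -1ℤ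

  IsSign-* : ∀ {x y} → IsSign x → IsSign y → IsSign (x * y)
  IsSign-* (inj₁ refl) (inj₁ refl) = inj₁ refl
  IsSign-* (inj₁ refl) (inj₂ refl) = inj₂ refl
  IsSign-* (inj₂ refl) (inj₁ refl) = inj₂ refl
  IsSign-* (inj₂ refl) (inj₂ refl) = inj₁ refl

  IsSign-square : ∀ {x} → IsSign x → x * x ≡ 1ℤ
  IsSign-square (inj₁ refl) = refl
  IsSign-square (inj₂ refl) = refl

  prime∤2 : ∀ {p} → Prime p → p ≢ 2 → ¬ p ℕ.∣ 2
  prime∤2 {0}                   (prime {{()}} _)
  prime∤2 {1}                   (prime {{()}} _)
  prime∤2 {2}                   _ p≢2 _    = p≢2 refl
  prime∤2 {suc (suc (suc _))} _ _   p∣2 = contradiction (ℕ.∣⇒≤ p∣2) λ { (ℕ.s≤s (ℕ.s≤s ())) }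

  IsSign-≡-mod⇒≡ : ∀ {p x y} → Prime p → p ≢ 2 → IsSign x → IsSign y → x ≡ y mod p → x ≡ y
  IsSign-≡-mod⇒≡ _ _ (inj₁ refl) (inj₁ refl) _ = refl
  IsSign-≡-mod⇒≡ _ _ (inj₂ refl) (inj₂ refl) _ = refl
  IsSign-≡-mod⇒≡ pr p≢2 (inj₁ refl) (inj₂ refl) (congruence p∣2) = contradiction (∣⇒∣ᵤ p∣2) (prime∤2 pr p≢2)
  IsSign-≡-mod⇒≡ pr p≢2 (inj₂ refl) (inj₁ refl) (congruence p∣-2) = contradiction (∣⇒∣ᵤ p∣-2) (prime∤2 pr p≢2)

  prime-odd : ∀ {p} → Prime p → p ≢ 2 → ¬ 2 ℕ.∣ p
  prime-odd {p} (prime notComposite) p≢2 2∣p =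
    notComposite (composite-≢ 2 {{_}} {{ℕ.nonTrivial⇒nonZero p}} (p≢2 ∘ sym) 2∣p)

  half-even : ∀ n → ¬ 2 ℕ.∣ suc n → n ℕ./ 2 ℕ.+ n ℕ./ 2 ≡ n
  half-even n 2∤1+n = halve (n ℕ.% 2) (m%n<n n 2) (m≡m%n+[m/n]*n n 2)
    where
    halve : ∀ r → r ℕ.< 2 → n ≡ r ℕ.+ n ℕ./ 2 ℕ.* 2 → n ℕ./ 2 ℕ.+ n ℕ./ 2 ≡ n
    halve 0 _ n≡2h   = sym (trans n≡2h (trans (ℕP.*-comm (n ℕ./ 2) 2)
                                              (cong (n ℕ./ 2 ℕ.+_) (ℕP.+-identityʳ (n ℕ./ 2)))))
    halve 1 _ n≡1+2h = contradiction (ℕ.divides (suc (n ℕ./ 2)) (cong suc n≡1+2h)) 2∤1+n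
    halve (suc (suc _)) (ℕ.s≤s (ℕ.s≤s ())) _

  residueSign : ℕ → ℤ
  residueSign zero          = 0ℤ
  residueSign (suc zero)    = 1ℤ
  residueSign (suc (suc _)) = -1ℤ

  legendre≡residueSign : ∀ x n →
    legendre x (suc n) ≡ residueSign ((x %ℕ suc n) ℕ.^ (n ℕ./ 2) ℕ.% suc n)
  legendre≡residueSign x n with (x %ℕ suc n) ℕ.^ (n ℕ./ 2) ℕ.% suc n
  ... | zero        = refl
  ... | suc zero    = refl
  ... | suc (suc _) = refl

  residueSign-root-of-unity : ∀ {p r} → Prime p → r ℕ.< p → + r * + r ≡ 1ℤ mod p →
    IsSign (residueSign r) × residueSign r ≡ + r mod p
  residueSign-root-of-unity {r = zero} (prime {{nt}} _) _ (congruence p∣-1) =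
    contradiction (ℕ.∣1⇒≡1 (∣⇒∣ᵤ p∣-1)) (ℕ.nonTrivial⇒≢1 {{nt}})
  residueSign-root-of-unity {r = suc zero} _ _ _ = inj₁ refl , ≡⇒≡-mod refl
  residueSign-root-of-unity {p} {r@(suc (suc r′))} pr r<p (congruence p∣r²-1) =
    [ (λ p∣r-1 → contradiction (ℕ.∣⇒≤ (∣⇒∣ᵤ p∣r-1)) (ℕP.<⇒≱ (ℕP.<-trans (ℕP.n<1+n (suc r′)) r<p)))
    , (λ p∣r+1 → inj₂ refl , congruence (subst (+ p ∣_) (negate (+ r)) (∣m⇒∣-m p∣r+1)))
    ]′ (euclidsLemma-ℤ (+ r - 1ℤ) (+ r + 1ℤ) pr (subst (+ p ∣_) (factor (+ r)) p∣r²-1))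
    where
    factor : ∀ r → r * r - 1ℤ ≡ (r - 1ℤ) * (r + 1ℤ)
    factor = solve-∀
    negate : ∀ r → - (r + 1ℤ) ≡ -1ℤ - r
    negate = solve-∀

  euler-criterion : ∀ {n} → Prime (suc n) → suc n ≢ 2 → ∀ {x} → ¬ (+ suc n ∣ x) →
    IsSign (legendre x (suc n)) × legendre x (suc n) ≡ x ^ (n ℕ./ 2) mod suc n
  euler-criterion {n} pr p≢2 {x} p∤x =
    subst (λ s → IsSign s × s ≡ x ^ e mod p) (sym (legendre≡residueSign x n))
          (map₂ (λ s≡r → ≡-mod-trans s≡r r≡xᵉ) (residueSign-root-of-unity pr (m%n<n (a ℕ.^ e) p) r²≡1))
    where
    p = suc n
    e = n ℕ./ 2
    a = x %ℕ p
    r≡xᵉ : + (a ℕ.^ e ℕ.% p) ≡ x ^ e mod p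
    r≡xᵉ = begin
      + (a ℕ.^ e ℕ.% p)  ≈⟨ ≡-mod-sym (≡-mod-%ℕ (+ (a ℕ.^ e)) p) ⟩
      + (a ℕ.^ e)        ≡⟨ pos-^ a e ⟩
      (+ a) ^ e          ≈⟨ ^-cong-mod e (≡-mod-sym (≡-mod-%ℕ x p)) ⟩
      x ^ e              ∎
      where open ≡-mod-Reasoning p
    r²≡1 : + (a ℕ.^ e ℕ.% p) * + (a ℕ.^ e ℕ.% p) ≡ 1ℤ mod p
    r²≡1 = begin
      + (a ℕ.^ e ℕ.% p) * + (a ℕ.^ e ℕ.% p)  ≈⟨ *-cong-mod r≡xᵉ r≡xᵉ ⟩
      x ^ e * x ^ e                          ≡⟨ sym (ℤP.^-distribˡ-+-* x e e) ⟩
      x ^ (e ℕ.+ e)                          ≡⟨ cong (x ^_) (half-even n (prime-odd pr p≢2)) ⟩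
      x ^ n                                  ≈⟨ fermat-little pr p∤x ⟩
      1ℤ                                     ∎
      where open ≡-mod-Reasoning p

  legendre-* : ∀ {p} → Prime p → p ≢ 2 → ∀ {x y} → ¬ (+ p ∣ x) → ¬ (+ p ∣ y) →
    legendre (x * y) p ≡ legendre x p * legendre y p
  legendre-* {suc n} pr p≢2 {x} {y} p∤x p∤y =
    IsSign-≡-mod⇒≡ pr p≢2 (proj₁ Lxy) (IsSign-* (proj₁ Lx) (proj₁ Ly)) (begin
      legendre (x * y) p               ≈⟨ proj₂ Lxy ⟩
      (x * y) ^ e                      ≡⟨ ^-distribʳ-* x y e ⟩
      x ^ e * y ^ e                    ≈⟨ ≡-mod-sym (*-cong-mod (proj₂ Lx) (proj₂ Ly)) ⟩
      legendre x p * legendre y p      ∎)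
    where
    open ≡-mod-Reasoning (suc n)
    p = suc n
    e = n ℕ./ 2
    p∤xy : ¬ (+ p ∣ x * y)
    p∤xy p∣xy = [ p∤x , p∤y ]′ (euclidsLemma-ℤ x y pr p∣xy)
    Lx = euler-criterion pr p≢2 p∤x
    Ly = euler-criterion pr p≢2 p∤y
    Lxy = euler-criterion pr p≢2 p∤xy

module Kronecker where

  open import Data.Nat as ℕ using (ℕ; zero; suc)
  import Data.Nat.Properties as ℕP
  open import Data.Nat.Divisibility as ℕ using ()
  open import Data.Nat.Primality using (Prime; prime; _Rough_; 2-rough; ∤⇒rough-suc; rough∧∣⇒prime)
  open import Data.Bool using (if_then_else_)
  open import Data.Integer hiding (suc)
  import Data.Integer.Properties as ℤP
  open import Data.Integer.Divisibility.Signed using (_∣_; ∣-refl; ∣-trans; ∣-reflexive; ∣m⇒∣m*n; ∣n⇒∣m*n)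
  open import Data.Integer.Tactic.RingSolver using (solve-∀)
  open import Data.Product using (∃; _×_; _,_; proj₁; proj₂)
  open import Data.Sum using (inj₁; inj₂; [_,_]′)
  open import Function using (_∘_)
  open import Relation.Binary.PropositionalEquality
  open import Relation.Nullary using (¬_; Dec; does; yes; no; contradiction)
  open Congruence using (euclidsLemma-ℤ)
  open Legendre

  if-does-elim : ∀ {A : Set} (P : A → Set) {Q : Set} (q? : Dec Q) {x y : A} →
    (Q → P x) → (¬ Q → P y) → P (if does q? then x else y)
  if-does-elim P (yes q) on-yes on-no = on-yes q
  if-does-elim P (no ¬q) on-yes on-no = on-no ¬q

  leastDivFrom-prime : ∀ fuel d m → 2 ℕ.≤ d → d Rough m → m ℕ.≤ fuel ℕ.+ d → 2 ℕ.≤ m →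
    Prime (leastDivFrom fuel d m) × leastDivFrom fuel d m ℕ.∣ m
  leastDivFrom-prime zero       d m _ d-rough m≤d 2≤m =
    prime {{ℕ.n>1⇒nonTrivial 2≤m}} (d-rough ∘ λ m-composite → ℕ.hasNonTrivialDivisor-≤ m-composite m≤d) , ℕ.∣-refl
  leastDivFrom-prime (suc fuel) (suc d) m 2≤d d-rough m≤ 2≤m =
    if-does-elim (λ q → Prime q × q ℕ.∣ m) (m ℕ.% suc d ℕ.≟ 0)
      (λ m%d≡0 → let d∣m = ℕ.m%n≡0⇒n∣m m (suc d) m%d≡0 in
                 rough∧∣⇒prime {{ℕ.n>1⇒nonTrivial 2≤d}} d-rough d∣m , d∣m)
      (λ m%d≢0 → leastDivFrom-prime fuel (suc (suc d)) m (ℕP.m≤n⇒m≤1+n 2≤d)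
                   (∤⇒rough-suc (m%d≢0 ∘ ℕ.n∣m⇒m%n≡0 m (suc d)) d-rough)
                   (subst (m ℕ.≤_) (sym (ℕP.+-suc fuel (suc d))) m≤) 2≤m)

  lpf-prime : ∀ m → 2 ℕ.≤ m → Prime (lpf m) × lpf m ℕ.∣ m
  lpf-prime m 2≤m = leastDivFrom-prime m 2 m ℕP.≤-refl 2-rough (ℕP.m≤m+n m 2) 2≤m

  PrimeFactorsOddAndCoprime : ℕ → ℤ → Set
  PrimeFactorsOddAndCoprime m x = ∀ {p} → Prime p → p ℕ.∣ m → p ≢ 2 × ¬ (+ p ∣ x)

  module _ {m : ℕ} where

    coprime-∣ : ∀ {x y} → x ∣ y → PrimeFactorsOddAndCoprime m y → PrimeFactorsOddAndCoprime m x
    coprime-∣ x∣y m⊥y pr p∣m = proj₁ (m⊥y pr p∣m) , λ p∣x → proj₂ (m⊥y pr p∣m) (∣-trans p∣x x∣y)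

    coprime-square : ∀ {y} → PrimeFactorsOddAndCoprime m y → PrimeFactorsOddAndCoprime m (y * y)
    coprime-square {y} m⊥y pr p∣m =
      proj₁ (m⊥y pr p∣m) ,
      λ p∣y² → [ proj₂ (m⊥y pr p∣m) , proj₂ (m⊥y pr p∣m) ]′ (euclidsLemma-ℤ y y pr p∣y²)

  coprime-/ : ∀ {m d x} .{{_ : ℕ.NonZero d}} → d ℕ.∣ m →
    PrimeFactorsOddAndCoprime m x → PrimeFactorsOddAndCoprime (m ℕ./ d) x
  coprime-/ d∣m m⊥x pr p∣m/d = m⊥x pr (ℕ.∣-trans p∣m/d (ℕ.m/n∣m d∣m))

  kronPrime≡legendre : ∀ x {p} → p ≢ 2 → kronPrime x p ≡ legendre x p
  kronPrime≡legendre x {p} p≢2 =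
    if-does-elim (_≡ legendre x p) (p ℕ.≟ 2) (λ p≡2 → contradiction p≡2 p≢2) (λ _ → refl)

  kronPos-sign : ∀ fuel m {x} → PrimeFactorsOddAndCoprime m x → IsSign (kronPos fuel x m)
  kronPos-sign zero       m m⊥x = inj₁ refl
  kronPos-sign (suc fuel) m {x} m⊥x with m ℕ.≤? 1
  ... | yes _   = inj₁ refl
  ... | no  m≰1 with lpf m | lpf-prime m (ℕP.≰⇒> m≰1)
  ...   | p@(suc _) | pr , p∣m =
    IsSign-* (subst IsSign (sym (kronPrime≡legendre x p≢2)) (proj₁ (euler-criterion pr p≢2 p∤x)))
             (kronPos-sign fuel (m ℕ./ p) (coprime-/ p∣m m⊥x))
    where
    p≢2 = proj₁ (m⊥x pr p∣m)
    p∤x = proj₂ (m⊥x pr p∣m)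

  kronPos-* : ∀ fuel m {x y} → PrimeFactorsOddAndCoprime m (x * y) →
    kronPos fuel (x * y) m ≡ kronPos fuel x m * kronPos fuel y m
  kronPos-* zero       m m⊥xy = refl
  kronPos-* (suc fuel) m {x} {y} m⊥xy with m ℕ.≤? 1
  ... | yes _   = refl
  ... | no  m≰1 with lpf m | lpf-prime m (ℕP.≰⇒> m≰1)
  ...   | p@(suc _) | pr , p∣m = begin
    kronPrime (x * y) p * kronPos fuel (x * y) (m ℕ./ p)
      ≡⟨ cong₂ _*_ (trans (kronPrime≡legendre (x * y) p≢2) (legendre-* pr p≢2 {x} {y} p∤x p∤y))
                   (kronPos-* fuel (m ℕ./ p) (coprime-/ p∣m m⊥xy)) ⟩
    legendre x p * legendre y p * (kronPos fuel x (m ℕ./ p) * kronPos fuel y (m ℕ./ p))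
      ≡⟨ interchange (legendre x p) (legendre y p) (kronPos fuel x (m ℕ./ p)) (kronPos fuel y (m ℕ./ p)) ⟩
    legendre x p * kronPos fuel x (m ℕ./ p) * (legendre y p * kronPos fuel y (m ℕ./ p))
      ≡⟨ cong₂ (λ u v → u * kronPos fuel x (m ℕ./ p) * (v * kronPos fuel y (m ℕ./ p)))
               (sym (kronPrime≡legendre x p≢2)) (sym (kronPrime≡legendre y p≢2)) ⟩
    kronPrime x p * kronPos fuel x (m ℕ./ p) * (kronPrime y p * kronPos fuel y (m ℕ./ p)) ∎
    where
    open ≡-Reasoning
    p≢2 = proj₁ (m⊥xy pr p∣m)
    p∤x = proj₂ (coprime-∣ (∣m⇒∣m*n y ∣-refl) m⊥xy pr p∣m)
    p∤y = proj₂ (coprime-∣ (∣n⇒∣m*n x ∣-refl) m⊥xy pr p∣m)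
    interchange : ∀ a b c d → a * b * (c * d) ≡ a * c * (b * d)
    interchange = solve-∀

  kronecker-negative : ∀ {h} → h ≢ 0ℤ →
    ∃ λ ε → IsSign ε × ∀ n → kronecker -[1+ n ] h ≡ ε * kronPos (∣ h ∣) -[1+ n ] (∣ h ∣)
  kronecker-negative {+ zero}    h≢0 = contradiction refl h≢0
  kronecker-negative {+ suc _}   _   = 1ℤ , inj₁ refl , λ n → sym (ℤP.*-identityˡ _)
  kronecker-negative { -[1+ _ ]} _   = -1ℤ , inj₂ refl , λ n → refl

  kronPos-square-product : ∀ {m y} A B C D → PrimeFactorsOddAndCoprime m y → A * B * (C * D) ≡ y * y →
    kronPos m A m * kronPos m B m * (kronPos m C m * kronPos m D m) ≡ 1ℤ
  kronPos-square-product {m} {y} A B C D m⊥y ABCD≡y² = begin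
    κ A * κ B * (κ C * κ D)  ≡⟨ cong₂ _*_ (sym (kronPos-* m m (coprime AB∣y²))) (sym (kronPos-* m m (coprime CD∣y²))) ⟩
    κ (A * B) * κ (C * D)    ≡⟨ sym (kronPos-* m m (coprime (∣-reflexive ABCD≡y²))) ⟩
    κ (A * B * (C * D))      ≡⟨ cong κ ABCD≡y² ⟩
    κ (y * y)                ≡⟨ kronPos-* m m (coprime-square m⊥y) ⟩
    κ y * κ y                ≡⟨ IsSign-square (kronPos-sign m m m⊥y) ⟩
    1ℤ                       ∎
    where
    open ≡-Reasoning
    κ : ℤ → ℤ
    κ x = kronPos m x m
    coprime : ∀ {x} → x ∣ y * y → PrimeFactorsOddAndCoprime m x
    coprime x∣y² = coprime-∣ x∣y² (coprime-square m⊥y)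
    AB∣y² : A * B ∣ y * y
    AB∣y² = subst (A * B ∣_) ABCD≡y² (∣m⇒∣m*n (C * D) ∣-refl)
    CD∣y² : C * D ∣ y * y
    CD∣y² = subst (C * D ∣_) ABCD≡y² (∣n⇒∣m*n (A * B) ∣-refl)

  SignsWithProductOne : ℤ → ℤ → ℤ → ℤ → Set
  SignsWithProductOne a b c d = IsSign a × IsSign b × IsSign c × IsSign d × a * b * c * d ≡ 1ℤ

  kronecker-square-product : ∀ {h y} → h ≢ 0ℤ → PrimeFactorsOddAndCoprime ∣ h ∣ y → ∀ a b c d →
    -[1+ a ] * -[1+ b ] * (-[1+ c ] * -[1+ d ]) ≡ y * y →
    SignsWithProductOne (kronecker -[1+ a ] h) (kronecker -[1+ b ] h)
                        (kronecker -[1+ c ] h) (kronecker -[1+ d ] h)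
  kronecker-square-product {h} {y} h≢0 h⊥y a b c d ABCD≡y² =
    χ-sign (∣m⇒∣m*n (C * D) (∣m⇒∣m*n B ∣-refl)) , χ-sign (∣m⇒∣m*n (C * D) (∣n⇒∣m*n A ∣-refl)) ,
    χ-sign (∣n⇒∣m*n (A * B) (∣m⇒∣m*n D ∣-refl)) , χ-sign (∣n⇒∣m*n (A * B) (∣n⇒∣m*n C ∣-refl)) , (begin
      χ a * χ b * χ c * χ d
        ≡⟨ cong₂ _*_ (cong₂ _*_ (cong₂ _*_ (χ≡εκ a) (χ≡εκ b)) (χ≡εκ c)) (χ≡εκ d) ⟩
      ε * κ A * (ε * κ B) * (ε * κ C) * (ε * κ D)
        ≡⟨ regroup ε (κ A) (κ B) (κ C) (κ D) ⟩
      (ε * ε) * (ε * ε) * (κ A * κ B * (κ C * κ D))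
        ≡⟨ cong₂ (λ ε² κ⁴ → ε² * ε² * κ⁴) (IsSign-square ε-sign)
                 (kronPos-square-product A B C D h⊥y ABCD≡y²) ⟩
      1ℤ ∎)
    where
    open ≡-Reasoning
    A = -[1+ a ]
    B = -[1+ b ]
    C = -[1+ c ]
    D = -[1+ d ]
    ε = proj₁ (kronecker-negative h≢0)
    ε-sign = proj₁ (proj₂ (kronecker-negative h≢0))
    χ≡εκ = proj₂ (proj₂ (kronecker-negative h≢0))
    χ : ℕ → ℤ
    χ n = kronecker -[1+ n ] h
    κ : ℤ → ℤ
    κ x = kronPos (∣ h ∣) x (∣ h ∣)
    χ-sign : ∀ {n} → -[1+ n ] ∣ A * B * (C * D) → IsSign (χ n)
    χ-sign {n} -n∣ABCD = subst IsSign (sym (χ≡εκ n)) (IsSign-* ε-sign (kronPos-sign (∣ h ∣) (∣ h ∣)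
      (coprime-∣ (subst (-[1+ n ] ∣_) ABCD≡y² -n∣ABCD) (coprime-square h⊥y))))
    regroup : ∀ e u v w z → e * u * (e * v) * (e * w) * (e * z) ≡ (e * e) * (e * e) * (u * v * (w * z))
    regroup = solve-∀

module IntegerCast where

  open import Data.Nat as ℕ using (ℕ; suc)
  import Data.Nat.Properties as ℕP
  open import Data.Vec using ([])
  open import Data.Integer as ℤ using (ℤ; +_; 1ℤ)
  import Data.Integer.Properties as ℤP
  open import Data.Integer.Tactic.RingSolver as ℤ-Solver using ()
  open import Data.Rational as ℚ using (ℚ; _/_; 1ℚ; fromℚᵘ)
  import Data.Rational.Properties as ℚP
  open import Data.Rational.Unnormalised as ℚᵘ using (mkℚᵘ; *≡*)
  import Data.Rational.Unnormalised.Properties as ℚᵘP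
  open import Algebra.Bundles.Raw using (RawRing)
  import Algebra.Definitions.RawSemiring as RawSemiringDefinitions
  open import Tactic.RingSolver.Core.Expression using (Expr; Κ; _⊕_; _⊗_; _⊛_; ⊝_; module Eval)
  open import Function using (id)
  open import Relation.Binary.PropositionalEquality

  fromℚᵘ-homo-+ : ∀ p q → fromℚᵘ (p ℚᵘ.+ q) ≡ fromℚᵘ p ℚ.+ fromℚᵘ q
  fromℚᵘ-homo-+ p q = ℚP.toℚᵘ-injective (ℚᵘP.≃-trans (ℚP.toℚᵘ-fromℚᵘ (p ℚᵘ.+ q))
    (ℚᵘP.≃-sym (ℚᵘP.≃-trans (ℚP.toℚᵘ-homo-+ (fromℚᵘ p) (fromℚᵘ q))
                            (ℚᵘP.+-cong (ℚP.toℚᵘ-fromℚᵘ p) (ℚP.toℚᵘ-fromℚᵘ q)))))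

  fromℚᵘ-homo-* : ∀ p q → fromℚᵘ (p ℚᵘ.* q) ≡ fromℚᵘ p ℚ.* fromℚᵘ q
  fromℚᵘ-homo-* p q = ℚP.toℚᵘ-injective (ℚᵘP.≃-trans (ℚP.toℚᵘ-fromℚᵘ (p ℚᵘ.* q))
    (ℚᵘP.≃-sym (ℚᵘP.≃-trans (ℚP.toℚᵘ-homo-* (fromℚᵘ p) (fromℚᵘ q))
                            (ℚᵘP.*-cong (ℚP.toℚᵘ-fromℚᵘ p) (ℚP.toℚᵘ-fromℚᵘ q)))))

  fromℚᵘ-homo-neg : ∀ p → fromℚᵘ (ℚᵘ.- p) ≡ ℚ.- fromℚᵘ p
  fromℚᵘ-homo-neg p = ℚP.toℚᵘ-injective (ℚᵘP.≃-trans (ℚP.toℚᵘ-fromℚᵘ (ℚᵘ.- p))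
    (ℚᵘP.≃-sym (ℚᵘP.≃-trans (ℚP.toℚᵘ-homo‿- (fromℚᵘ p)) (ℚᵘP.-‿cong (ℚP.toℚᵘ-fromℚᵘ p)))))

  ℤ→ℚ-+ : ∀ a b → ℤ→ℚ (a ℤ.+ b) ≡ ℤ→ℚ a ℚ.+ ℤ→ℚ b
  ℤ→ℚ-+ a b =
    trans (ℚP.fromℚᵘ-cong {mkℚᵘ (a ℤ.+ b) 0} {mkℚᵘ a 0 ℚᵘ.+ mkℚᵘ b 0} (*≡* (cross-multiplied a b)))
          (fromℚᵘ-homo-+ (mkℚᵘ a 0) (mkℚᵘ b 0))
    where
    cross-multiplied : ∀ a b → (a ℤ.+ b) ℤ.* 1ℤ ≡ (a ℤ.* 1ℤ ℤ.+ b ℤ.* 1ℤ) ℤ.* 1ℤ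
    cross-multiplied = ℤ-Solver.solve-∀

  ℤ→ℚ-* : ∀ a b → ℤ→ℚ (a ℤ.* b) ≡ ℤ→ℚ a ℚ.* ℤ→ℚ b
  ℤ→ℚ-* a b = fromℚᵘ-homo-* (mkℚᵘ a 0) (mkℚᵘ b 0)

  ℤ→ℚ-neg : ∀ a → ℤ→ℚ (ℤ.- a) ≡ ℚ.- ℤ→ℚ a
  ℤ→ℚ-neg a = fromℚᵘ-homo-neg (mkℚᵘ a 0)

  module ℤ-Eval = Eval ℤ.+-*-rawRing id
  module ℚ-Eval = Eval ℚ.+-*-rawRing ℤ→ℚ
  module ℤ^ = RawSemiringDefinitions (RawRing.rawSemiring ℤ.+-*-rawRing)
  module ℚ^ = RawSemiringDefinitions (RawRing.rawSemiring ℚ.+-*-rawRing)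

  ℤ→ℚ-^′ : ∀ a n → ℤ→ℚ (a ℤ^.^′ n) ≡ ℤ→ℚ a ℚ^.^′ n
  ℤ→ℚ-^′ a 0             = refl
  ℤ→ℚ-^′ a 1             = refl
  ℤ→ℚ-^′ a (suc (suc n)) = trans (ℤ→ℚ-* (a ℤ^.^′ suc n) a) (cong (ℚ._* ℤ→ℚ a) (ℤ→ℚ-^′ a (suc n)))

  -- Expressions have no variables: the integers they mention are constants Κ, which ℚ⟦_⟧ reads
  -- through ℤ→ℚ, so ℤ→ℚ-⟦⟧ pushes the cast through any integer polynomial.
  ℤ⟦_⟧ : Expr ℤ 0 → ℤ
  ℤ⟦ e ⟧ = ℤ-Eval.⟦ e ⟧ []

  ℚ⟦_⟧ : Expr ℤ 0 → ℚ
  ℚ⟦ e ⟧ = ℚ-Eval.⟦ e ⟧ []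

  ℤ→ℚ-⟦⟧ : ∀ e → ℤ→ℚ ℤ⟦ e ⟧ ≡ ℚ⟦ e ⟧
  ℤ→ℚ-⟦⟧ (Κ a)   = refl
  ℤ→ℚ-⟦⟧ (e ⊕ f) = trans (ℤ→ℚ-+ ℤ⟦ e ⟧ ℤ⟦ f ⟧) (cong₂ ℚ._+_ (ℤ→ℚ-⟦⟧ e) (ℤ→ℚ-⟦⟧ f))
  ℤ→ℚ-⟦⟧ (e ⊗ f) = trans (ℤ→ℚ-* ℤ⟦ e ⟧ ℤ⟦ f ⟧) (cong₂ ℚ._*_ (ℤ→ℚ-⟦⟧ e) (ℤ→ℚ-⟦⟧ f))
  ℤ→ℚ-⟦⟧ (e ⊛ n) = trans (ℤ→ℚ-^′ ℤ⟦ e ⟧ n) (cong (ℚ^._^′ n) (ℤ→ℚ-⟦⟧ e))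
  ℤ→ℚ-⟦⟧ (⊝ e)   = trans (ℤ→ℚ-neg ℤ⟦ e ⟧) (cong ℚ.-_ (ℤ→ℚ-⟦⟧ e))

  inv-* : ∀ m n → inv (suc m ℕ.* suc n) ≡ inv (suc m) ℚ.* inv (suc n)
  inv-* m n = fromℚᵘ-homo-* (mkℚᵘ 1ℤ m) (mkℚᵘ 1ℤ n)

  inv-inverseˡ : ∀ n → inv (suc n) ℚ.* ℤ→ℚ (+ suc n) ≡ 1ℚ
  inv-inverseˡ n = trans (sym (fromℚᵘ-homo-* (mkℚᵘ 1ℤ n) (mkℚᵘ (+ suc n) 0)))
    (ℚP.fromℚᵘ-cong {mkℚᵘ 1ℤ n ℚᵘ.* mkℚᵘ (+ suc n) 0} {mkℚᵘ 1ℤ 0} (*≡* cross-multiplied))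
    where
    cross-multiplied : (1ℤ ℤ.* + suc n) ℤ.* 1ℤ ≡ 1ℤ ℤ.* + suc (n ℕ.* 1)
    cross-multiplied = trans (ℤP.*-identityʳ (1ℤ ℤ.* + suc n))
                             (cong (λ m → 1ℤ ℤ.* + suc m) (sym (ℕP.*-identityʳ n)))

  /-as-* : ∀ z n → z / suc n ≡ ℤ→ℚ z ℚ.* inv (suc n)
  /-as-* z n = trans (ℚP.fromℚᵘ-cong {mkℚᵘ z n} {mkℚᵘ z 0 ℚᵘ.* mkℚᵘ 1ℤ n} (*≡* cross-multiplied))
                     (fromℚᵘ-homo-* (mkℚᵘ z 0) (mkℚᵘ 1ℤ n))
    where
    cross-multiplied : z ℤ.* + suc (n ℕ.+ 0) ≡ (z ℤ.* 1ℤ) ℤ.* + suc n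
    cross-multiplied = trans (cong (λ m → z ℤ.* + suc m) (ℕP.+-identityʳ n))
                             (cong (ℤ._* + suc n) (sym (ℤP.*-identityʳ z)))

  ℤ→ℚ-pos-* : ∀ m n → ℤ→ℚ (+ (m ℕ.* n)) ≡ ℤ→ℚ (+ m) ℚ.* ℤ→ℚ (+ n)
  ℤ→ℚ-pos-* m n = trans (cong ℤ→ℚ (ℤP.pos-* m n)) (ℤ→ℚ-* (+ m) (+ n))

module Angles where

  open import Data.Nat as ℕ using (ℕ; suc)
  open import Data.Integer as ℤ using (ℤ; +_; 1ℤ)
  import Data.Integer.Properties as ℤP
  open import Data.Rational as ℚ using (ℚ; _/_; 1ℚ)
  import Data.Rational.Properties as ℚP
  open import Data.Bool using (true)
  open import Data.Bool.Properties using (if-cong)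
  open import Data.Product using (∃-syntax; _,_; proj₁; proj₂)
  open import Data.Sum using (inj₁; inj₂)
  open import Data.Integer.Divisibility.Signed as ℤ∣ using ()
  open import Level using (0ℓ)
  open import Relation.Binary.PropositionalEquality
  open import Relation.Nullary.Decidable using (dec⇒maybe)
  open import Tactic.RingSolver using (solve-∀)
  open import Tactic.RingSolver.Core.AlmostCommutativeRing using (AlmostCommutativeRing; fromCommutativeRing)
  open import Tactic.RingSolver.Core.Expression using (Expr; Κ; _⊕_; _⊗_; ⊝_)
  open Kronecker using (SignsWithProductOne)
  open IntegerCast

  -- Without the zero test the solver's normal forms keep vanishing coefficients and are not canonical.
  ℚ-ring : AlmostCommutativeRing 0ℓ 0ℓ
  ℚ-ring = fromCommutativeRing ℚP.+-*-commutativeRing (λ x → dec⇒maybe (ℚ.0ℚ ℚ.≟ x))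

  -- The last three summands vanish: the sign angles sum to 2E, A₁ + 2A₂ + 3A₃ − 6A₄ = 6MT, and M⁻¹M = 1.
  angle-combination : ∀ (H Q M M⁻¹ T E s₁ s₂ s₃ s₄ A₁ A₂ A₃ A₄ : ℚ) →
    let ω = λ s C C⁻¹ A → s ℚ.- (+ 1 / 4) ℚ.* ((+ 2 / 1) ℚ.- H ℚ.* C ℚ.- H)
              ℚ.- (+ 1 / 12) ℚ.* (C ℚ.- C⁻¹) ℚ.* ((+ 2 / 1) ℚ.* H ℚ.- A ℚ.+ ((+ 24 / 1) ℚ.* Q ℚ.+ 1ℚ) ℚ.* A)
    in ω s₁ (M ℚ.* (+ 6 / 1)) (M⁻¹ ℚ.* (+ 1 / 6)) A₁ ℚ.+ ω s₂ (M ℚ.* (+ 3 / 1)) (M⁻¹ ℚ.* (+ 1 / 3)) A₂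
         ℚ.+ ω s₃ (M ℚ.* (+ 2 / 1)) (M⁻¹ ℚ.* (+ 1 / 2)) A₃ ℚ.- ω s₄ M M⁻¹ A₄
         ℚ.- (1ℚ ℚ.+ ((+ 5 / 1) ℚ.* (M ℚ.* (+ 6 / 1)) ℚ.+ (+ 18 / 1)) ℚ.* H ℚ.* (+ 1 / 36))
       ≡ (E ℚ.- 1ℚ ℚ.- Q ℚ.* M ℚ.* ((+ 6 / 1) ℚ.* A₁ ℚ.+ (+ 3 / 1) ℚ.* A₂ ℚ.+ (+ 2 / 1) ℚ.* A₃ ℚ.- A₄) ℚ.+ Q ℚ.* T) ℚ.* (+ 2 / 1)
         ℚ.+ (s₁ ℚ.+ s₂ ℚ.+ s₃ ℚ.- s₄ ℚ.- (+ 2 / 1) ℚ.* E)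
         ℚ.+ Q ℚ.* M⁻¹ ℚ.* (+ 1 / 3) ℚ.* (A₁ ℚ.+ A₂ ℚ.* (+ 2 / 1) ℚ.+ A₃ ℚ.* (+ 3 / 1) ℚ.- A₄ ℚ.* (+ 6 / 1) ℚ.- T ℚ.* (M ℚ.* (+ 6 / 1)))
         ℚ.+ (+ 2 / 1) ℚ.* Q ℚ.* T ℚ.* (M⁻¹ ℚ.* M ℚ.- 1ℚ)
  angle-combination = solve-∀ ℚ-ring

  cancel-vanishing : ∀ (x y z w : ℚ) → x ℚ.+ ℚ.0ℚ ℚ.+ y ℚ.* ℚ.0ℚ ℚ.+ z ℚ.* (w ℚ.- w) ≡ x
  cancel-vanishing = solve-∀ ℚ-ring

  signAngle-sum-even : ∀ {a b c d} → SignsWithProductOne a b c d → ∃[ e ]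
    signAngle a ℚ.+ signAngle b ℚ.+ signAngle c ℚ.- signAngle d ℚ.- (+ 2 / 1) ℚ.* ℤ→ℚ e ≡ ℚ.0ℚ
  signAngle-sum-even (inj₁ refl , inj₁ refl , inj₁ refl , inj₁ refl , _) = + 0 , refl
  signAngle-sum-even (inj₁ refl , inj₁ refl , inj₂ refl , inj₂ refl , _) = + 0 , refl
  signAngle-sum-even (inj₁ refl , inj₂ refl , inj₁ refl , inj₂ refl , _) = + 0 , refl
  signAngle-sum-even (inj₁ refl , inj₂ refl , inj₂ refl , inj₁ refl , _) = + 1 , refl
  signAngle-sum-even (inj₂ refl , inj₁ refl , inj₁ refl , inj₂ refl , _) = + 0 , refl
  signAngle-sum-even (inj₂ refl , inj₁ refl , inj₂ refl , inj₁ refl , _) = + 1 , refl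
  signAngle-sum-even (inj₂ refl , inj₂ refl , inj₁ refl , inj₁ refl , _) = + 1 , refl
  signAngle-sum-even (inj₂ refl , inj₂ refl , inj₂ refl , inj₂ refl , _) = + 1 , refl
  signAngle-sum-even (inj₁ refl , inj₁ refl , inj₁ refl , inj₂ refl , ())
  signAngle-sum-even (inj₁ refl , inj₁ refl , inj₂ refl , inj₁ refl , ())
  signAngle-sum-even (inj₁ refl , inj₂ refl , inj₁ refl , inj₁ refl , ())
  signAngle-sum-even (inj₁ refl , inj₂ refl , inj₂ refl , inj₂ refl , ())
  signAngle-sum-even (inj₂ refl , inj₁ refl , inj₁ refl , inj₁ refl , ())
  signAngle-sum-even (inj₂ refl , inj₁ refl , inj₂ refl , inj₂ refl , ())
  signAngle-sum-even (inj₂ refl , inj₂ refl , inj₁ refl , inj₂ refl , ())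
  signAngle-sum-even (inj₂ refl , inj₂ refl , inj₂ refl , inj₁ refl , ())

  ωAngle-odd : ∀ a q c a′ → isOdd a ≡ true → a ℤ.* a ≡ + 24 ℤ.* q ℤ.+ 1ℤ →
    ωAngle a c a′ ≡
      signAngle (kronecker (ℤ.- (+ c)) a) ℚ.- (+ 1 / 4) ℚ.* ((+ 2 / 1) ℚ.- ℤ→ℚ a ℚ.* ℤ→ℚ (+ c) ℚ.- ℤ→ℚ a)
      ℚ.- (+ 1 / 12) ℚ.* (ℤ→ℚ (+ c) ℚ.- inv c)
          ℚ.* ((+ 2 / 1) ℚ.* ℤ→ℚ a ℚ.- ℤ→ℚ a′ ℚ.+ ((+ 24 / 1) ℚ.* ℤ→ℚ q ℚ.+ 1ℚ) ℚ.* ℤ→ℚ a′)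
  ωAngle-odd a q c a′ a-odd a²≡24q+1 = trans (if-cong a-odd) (cong₂
    (λ X Y → signAngle (kronecker (ℤ.- (+ c)) a) ℚ.- (+ 1 / 4) ℚ.* X ℚ.- (+ 1 / 12) ℚ.* (ℤ→ℚ (+ c) ℚ.- inv c) ℚ.* Y)
    (ℤ→ℚ-⟦⟧ (Κ (+ 2) ⊕ ⊝ (Κ a ⊗ Κ (+ c)) ⊕ ⊝ Κ a))
    (trans (cong (λ a² → ℤ→ℚ (+ 2 ℤ.* a ℤ.- a′ ℤ.+ a² ℤ.* a′)) a²≡24q+1)
           (ℤ→ℚ-⟦⟧ (Κ (+ 2) ⊗ Κ a ⊕ ⊝ Κ a′ ⊕ (Κ (+ 24) ⊗ Κ q ⊕ Κ 1ℤ) ⊗ Κ a′))))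


  module _ (M′ : ℕ) (h h₁ h₂ h₃ h₆ : ℤ) (h-odd : isOdd h ≡ true)
    (h²≡24q+1 : ∃[ q ] h ℤ.* h ≡ + 24 ℤ.* q ℤ.+ 1ℤ)
    (6M∣u : + (suc M′ ℕ.* 6) ℤ∣.∣ h₁ ℤ.+ h₂ ℤ.* + 2 ℤ.+ h₃ ℤ.* + 3 ℤ.- h₆ ℤ.* + 6)
    (signs≡2e : ∃[ e ] signAngle (kronecker (ℤ.- (+ (suc M′ ℕ.* 6))) h)
                       ℚ.+ signAngle (kronecker (ℤ.- (+ (suc M′ ℕ.* 3))) h)
                       ℚ.+ signAngle (kronecker (ℤ.- (+ (suc M′ ℕ.* 2))) h)
                       ℚ.- signAngle (kronecker (ℤ.- (+ suc M′)) h)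
                       ℚ.- (+ 2 / 1) ℚ.* ℤ→ℚ e ≡ ℚ.0ℚ)
    where

    private
      M = suc M′
      q = proj₁ h²≡24q+1
      t = ℤ∣._∣_.quotient 6M∣u
      e = proj₁ signs≡2e
      u≡6Mt : h₁ ℤ.+ h₂ ℤ.* + 2 ℤ.+ h₃ ℤ.* + 3 ℤ.- h₆ ℤ.* + 6 ≡ t ℤ.* (+ M ℤ.* + 6)
      u≡6Mt = trans (ℤ∣._∣_.equality 6M∣u) (cong (t ℤ.*_) (ℤP.pos-* M 6))
      H = ℤ→ℚ h
      Q = ℤ→ℚ q
      T = ℤ→ℚ t
      E = ℤ→ℚ e
      Mℚ = ℤ→ℚ (+ M)
      M⁻¹ = inv M
      A₁ = ℤ→ℚ h₁
      A₂ = ℤ→ℚ h₂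
      A₃ = ℤ→ℚ h₃
      A₄ = ℤ→ℚ h₆
      s : ℕ → ℚ
      s c = signAngle (kronecker (ℤ.- (+ c)) h)

      ω : ℚ → ℚ → ℚ → ℚ → ℚ
      ω s C C⁻¹ A = s ℚ.- (+ 1 / 4) ℚ.* ((+ 2 / 1) ℚ.- H ℚ.* C ℚ.- H)
                    ℚ.- (+ 1 / 12) ℚ.* (C ℚ.- C⁻¹) ℚ.* ((+ 2 / 1) ℚ.* H ℚ.- A ℚ.+ ((+ 24 / 1) ℚ.* Q ℚ.+ 1ℚ) ℚ.* A)

      ωAngle-scaled : ∀ d a′ →
        ωAngle h (M ℕ.* suc d) a′ ≡ ω (s (M ℕ.* suc d)) (Mℚ ℚ.* ℤ→ℚ (+ suc d)) (M⁻¹ ℚ.* inv (suc d)) (ℤ→ℚ a′)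
      ωAngle-scaled d a′ = trans (ωAngle-odd h q (M ℕ.* suc d) a′ h-odd (proj₂ h²≡24q+1))
        (cong₂ (λ C C⁻¹ → ω (s (M ℕ.* suc d)) C C⁻¹ (ℤ→ℚ a′)) (ℤ→ℚ-pos-* M (suc d)) (inv-* M′ d))

      N : Expr ℤ 0
      N = Κ e ⊕ ⊝ Κ 1ℤ ⊕ ⊝ (Κ q ⊗ Κ (+ M) ⊗ (Κ (+ 6) ⊗ Κ h₁ ⊕ Κ (+ 3) ⊗ Κ h₂ ⊕ Κ (+ 2) ⊗ Κ h₃ ⊕ ⊝ Κ h₆))
          ⊕ Κ q ⊗ Κ t

      rhs : 1ℚ ℚ.+ ((+ 5 ℤ.* + (M ℕ.* 6) ℤ.+ + 18) ℤ.* h) / 36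
          ≡ 1ℚ ℚ.+ ((+ 5 / 1) ℚ.* (Mℚ ℚ.* (+ 6 / 1)) ℚ.+ (+ 18 / 1)) ℚ.* H ℚ.* (+ 1 / 36)
      rhs = cong (1ℚ ℚ.+_) (trans (/-as-* ((+ 5 ℤ.* + (M ℕ.* 6) ℤ.+ + 18) ℤ.* h) 35) (cong (ℚ._* (+ 1 / 36))
        (trans (cong (λ k → ℤ→ℚ ((+ 5 ℤ.* k ℤ.+ + 18) ℤ.* h)) (ℤP.pos-* M 6))
               (ℤ→ℚ-⟦⟧ ((Κ (+ 5) ⊗ (Κ (+ M) ⊗ Κ (+ 6)) ⊕ Κ (+ 18)) ⊗ Κ h)))))

      R≡0 : A₁ ℚ.+ A₂ ℚ.* (+ 2 / 1) ℚ.+ A₃ ℚ.* (+ 3 / 1) ℚ.- A₄ ℚ.* (+ 6 / 1) ℚ.- T ℚ.* (Mℚ ℚ.* (+ 6 / 1))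
          ≡ ℚ.0ℚ
      R≡0 = trans (cong (ℚ._- T ℚ.* (Mℚ ℚ.* (+ 6 / 1)))
                    (trans (sym (ℤ→ℚ-⟦⟧ (Κ h₁ ⊕ Κ h₂ ⊗ Κ (+ 2) ⊕ Κ h₃ ⊗ Κ (+ 3) ⊕ ⊝ (Κ h₆ ⊗ Κ (+ 6)))))
                    (trans (cong ℤ→ℚ u≡6Mt) (ℤ→ℚ-⟦⟧ (Κ t ⊗ (Κ (+ M) ⊗ Κ (+ 6)))))))
                  (ℚP.+-inverseʳ (T ℚ.* (Mℚ ℚ.* (+ 6 / 1))))

    ωAngle-sum : (ωAngle h (M ℕ.* 6) h₁ ℚ.+ ωAngle h (M ℕ.* 3) h₂ ℚ.+ ωAngle h (M ℕ.* 2) h₃ ℚ.- ωAngle h M h₆)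
      ≡[mod2] (1ℚ ℚ.+ ((+ 5 ℤ.* + (M ℕ.* 6) ℤ.+ + 18) ℤ.* h) / 36)
    ωAngle-sum = ℤ⟦ N ⟧ , (begin
      ωAngle h (M ℕ.* 6) h₁ ℚ.+ ωAngle h (M ℕ.* 3) h₂ ℚ.+ ωAngle h (M ℕ.* 2) h₃ ℚ.- ωAngle h M h₆
        ℚ.- (1ℚ ℚ.+ ((+ 5 ℤ.* + (M ℕ.* 6) ℤ.+ + 18) ℤ.* h) / 36)
        ≡⟨ cong₂ ℚ._-_ (cong₂ ℚ._-_ (cong₂ ℚ._+_ (cong₂ ℚ._+_ (ωAngle-scaled 5 h₁) (ωAngle-scaled 2 h₂)) (ωAngle-scaled 1 h₃))
                                    (ωAngle-odd h q M h₆ h-odd (proj₂ h²≡24q+1)))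
                       rhs ⟩
      ω (s (M ℕ.* 6)) (Mℚ ℚ.* (+ 6 / 1)) (M⁻¹ ℚ.* (+ 1 / 6)) A₁ ℚ.+ ω (s (M ℕ.* 3)) (Mℚ ℚ.* (+ 3 / 1)) (M⁻¹ ℚ.* (+ 1 / 3)) A₂
        ℚ.+ ω (s (M ℕ.* 2)) (Mℚ ℚ.* (+ 2 / 1)) (M⁻¹ ℚ.* (+ 1 / 2)) A₃ ℚ.- ω (s M) Mℚ M⁻¹ A₄
        ℚ.- (1ℚ ℚ.+ ((+ 5 / 1) ℚ.* (Mℚ ℚ.* (+ 6 / 1)) ℚ.+ (+ 18 / 1)) ℚ.* H ℚ.* (+ 1 / 36))
        ≡⟨ angle-combination H Q Mℚ M⁻¹ T E (s (M ℕ.* 6)) (s (M ℕ.* 3)) (s (M ℕ.* 2)) (s M) A₁ A₂ A₃ A₄ ⟩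
      ℚ⟦ N ⟧ ℚ.* (+ 2 / 1) ℚ.+ (s (M ℕ.* 6) ℚ.+ s (M ℕ.* 3) ℚ.+ s (M ℕ.* 2) ℚ.- s M ℚ.- (+ 2 / 1) ℚ.* E)
        ℚ.+ Q ℚ.* M⁻¹ ℚ.* (+ 1 / 3) ℚ.* (A₁ ℚ.+ A₂ ℚ.* (+ 2 / 1) ℚ.+ A₃ ℚ.* (+ 3 / 1) ℚ.- A₄ ℚ.* (+ 6 / 1) ℚ.- T ℚ.* (Mℚ ℚ.* (+ 6 / 1)))
        ℚ.+ (+ 2 / 1) ℚ.* Q ℚ.* T ℚ.* (M⁻¹ ℚ.* Mℚ ℚ.- 1ℚ)
        ≡⟨ cong₃ (λ x y z → ℚ⟦ N ⟧ ℚ.* (+ 2 / 1) ℚ.+ x ℚ.+ Q ℚ.* M⁻¹ ℚ.* (+ 1 / 3) ℚ.* y ℚ.+ (+ 2 / 1) ℚ.* Q ℚ.* T ℚ.* (z ℚ.- 1ℚ))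
                 (proj₂ signs≡2e) R≡0 (inv-inverseˡ M′) ⟩
      ℚ⟦ N ⟧ ℚ.* (+ 2 / 1) ℚ.+ ℚ.0ℚ ℚ.+ Q ℚ.* M⁻¹ ℚ.* (+ 1 / 3) ℚ.* ℚ.0ℚ ℚ.+ (+ 2 / 1) ℚ.* Q ℚ.* T ℚ.* (1ℚ ℚ.- 1ℚ)
        ≡⟨ cancel-vanishing (ℚ⟦ N ⟧ ℚ.* (+ 2 / 1)) (Q ℚ.* M⁻¹ ℚ.* (+ 1 / 3)) ((+ 2 / 1) ℚ.* Q ℚ.* T) 1ℚ ⟩
      ℚ⟦ N ⟧ ℚ.* (+ 2 / 1)
        ≡⟨ sym (ℤ→ℚ-⟦⟧ (N ⊗ Κ (+ 2))) ⟩
      ℤ→ℚ (ℤ⟦ N ⟧ ℤ.* + 2) ∎)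
      where
      open ≡-Reasoning

module CoprimeToSix where

  open import Data.Nat as ℕ using (ℕ; suc)
  import Data.Nat.Properties as ℕP
  open import Data.Nat.DivMod using (m≡m%n+[m/n]*n; m%n<n)
  open import Data.Nat.Divisibility as ℕ using (_∣_; divides)
  open import Data.Nat.Coprimality as Coprimality using (Coprime; coprime-divisor; gcd≡1⇒coprime)
  open import Data.Nat.GCD using (gcd; gcd-greatest)
  open import Data.Nat.Primality using (euclidsLemma; prime⇒nonTrivial)
  open import Data.Nat.Tactic.RingSolver as ℕ-Solver using ()
  open import Data.Integer as ℤ using (ℤ; +_; -[1+_]; ∣_∣; 0ℤ; 1ℤ)
  import Data.Integer.Properties as ℤP
  open import Data.Integer.Divisibility.Signed as ℤ∣ using (∣ᵤ⇒∣; ∣⇒∣ᵤ; *-monoˡ-∣; ∣m∣n⇒∣m+n; ∣m∣n⇒∣m-n)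
  open import Data.Integer.Tactic.RingSolver as ℤ-Solver using ()
  open import Data.Bool using (true)
  open import Data.Product using (∃; _,_)
  open import Data.Sum using (_⊎_; inj₁; inj₂; [_,_]′)
  open import Function using (_∘_)
  open import Relation.Binary.PropositionalEquality
  open import Relation.Nullary using (¬_; contradiction)
  open import Relation.Nullary.Decidable using (dec-true)
  open Kronecker using (PrimeFactorsOddAndCoprime)

  residue-square-mod-24 : ∀ r → r ℕ.< 12 → 2 ℕ.∣ r ⊎ 3 ℕ.∣ r ⊎ ∃ λ x → r ℕ.* r ≡ 24 ℕ.* x ℕ.+ 1
  residue-square-mod-24 0  _ = inj₁ (divides 0 refl)
  residue-square-mod-24 1  _ = inj₂ (inj₂ (0 , refl))
  residue-square-mod-24 2  _ = inj₁ (divides 1 refl)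
  residue-square-mod-24 3  _ = inj₂ (inj₁ (divides 1 refl))
  residue-square-mod-24 4  _ = inj₁ (divides 2 refl)
  residue-square-mod-24 5  _ = inj₂ (inj₂ (1 , refl))
  residue-square-mod-24 6  _ = inj₁ (divides 3 refl)
  residue-square-mod-24 7  _ = inj₂ (inj₂ (2 , refl))
  residue-square-mod-24 8  _ = inj₁ (divides 4 refl)
  residue-square-mod-24 9  _ = inj₂ (inj₁ (divides 3 refl))
  residue-square-mod-24 10 _ = inj₁ (divides 5 refl)
  residue-square-mod-24 11 _ = inj₂ (inj₂ (5 , refl))
  residue-square-mod-24 (suc (suc (suc (suc (suc (suc (suc (suc (suc (suc (suc (suc r)))))))))))) r<12 =
    contradiction (ℕP.m≤m+n 12 r) (ℕP.<⇒≱ r<12)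

  square-mod-24 : ∀ n → ¬ 2 ℕ.∣ n → ¬ 3 ℕ.∣ n → ∃ λ q → n ℕ.* n ≡ 24 ℕ.* q ℕ.+ 1
  square-mod-24 n 2∤n 3∤n = from-residue {d = n ℕ./ 12} (m≡m%n+[m/n]*n n 12) 2∤n 3∤n
                                         (residue-square-mod-24 (n ℕ.% 12) (m%n<n n 12))
    where
    from-residue : ∀ {n r d} → n ≡ r ℕ.+ d ℕ.* 12 → ¬ 2 ℕ.∣ n → ¬ 3 ℕ.∣ n →
      2 ℕ.∣ r ⊎ 3 ℕ.∣ r ⊎ (∃ λ x → r ℕ.* r ≡ 24 ℕ.* x ℕ.+ 1) → ∃ λ q → n ℕ.* n ≡ 24 ℕ.* q ℕ.+ 1
    from-residue {d = d} refl 2∤n _ (inj₁ 2∣r) =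
      contradiction (ℕ.∣m∣n⇒∣m+n 2∣r (divides (d ℕ.* 6) (twelve d))) 2∤n
      where twelve : ∀ d → d ℕ.* 12 ≡ d ℕ.* 6 ℕ.* 2
            twelve = ℕ-Solver.solve-∀
    from-residue {d = d} refl _ 3∤n (inj₂ (inj₁ 3∣r)) =
      contradiction (ℕ.∣m∣n⇒∣m+n 3∣r (divides (d ℕ.* 4) (twelve d))) 3∤n
      where twelve : ∀ d → d ℕ.* 12 ≡ d ℕ.* 4 ℕ.* 3
            twelve = ℕ-Solver.solve-∀
    from-residue {r = r} {d} refl _ _ (inj₂ (inj₂ (x , r²≡24x+1))) =
      x ℕ.+ (r ℕ.* d ℕ.+ 6 ℕ.* d ℕ.* d) , (begin
        (r ℕ.+ d ℕ.* 12) ℕ.* (r ℕ.+ d ℕ.* 12)        ≡⟨ expand r d ⟩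
        r ℕ.* r ℕ.+ 24 ℕ.* (r ℕ.* d ℕ.+ 6 ℕ.* d ℕ.* d) ≡⟨ cong (ℕ._+ 24 ℕ.* (r ℕ.* d ℕ.+ 6 ℕ.* d ℕ.* d)) r²≡24x+1 ⟩
        24 ℕ.* x ℕ.+ 1 ℕ.+ 24 ℕ.* (r ℕ.* d ℕ.+ 6 ℕ.* d ℕ.* d) ≡⟨ collect x (r ℕ.* d ℕ.+ 6 ℕ.* d ℕ.* d) ⟩
        24 ℕ.* (x ℕ.+ (r ℕ.* d ℕ.+ 6 ℕ.* d ℕ.* d)) ℕ.+ 1 ∎)
      where
      open ≡-Reasoning
      expand : ∀ r d → (r ℕ.+ d ℕ.* 12) ℕ.* (r ℕ.+ d ℕ.* 12) ≡ r ℕ.* r ℕ.+ 24 ℕ.* (r ℕ.* d ℕ.+ 6 ℕ.* d ℕ.* d)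
      expand = ℕ-Solver.solve-∀
      collect : ∀ x y → 24 ℕ.* x ℕ.+ 1 ℕ.+ 24 ℕ.* y ≡ 24 ℕ.* (x ℕ.+ y) ℕ.+ 1
      collect = ℕ-Solver.solve-∀

  square-abs : ∀ h → h ℤ.* h ≡ + (∣ h ∣ ℕ.* ∣ h ∣)
  square-abs (+ n)    = sym (ℤP.pos-* n n)
  square-abs -[1+ n ] = refl

  square-mod-24-ℤ : ∀ h → ¬ 2 ℕ.∣ ∣ h ∣ → ¬ 3 ℕ.∣ ∣ h ∣ → ∃ λ q → h ℤ.* h ≡ + 24 ℤ.* q ℤ.+ 1ℤ
  square-mod-24-ℤ h 2∤h 3∤h with square-mod-24 ∣ h ∣ 2∤h 3∤h
  ... | q , h²≡24q+1 = + q , trans (square-abs h)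
    (trans (cong +_ h²≡24q+1) (trans (ℤP.pos-+ (24 ℕ.* q) 1) (cong (ℤ._+ 1ℤ) (ℤP.pos-* 24 q))))

  isOdd-true : ∀ h → ¬ 2 ℕ.∣ ∣ h ∣ → isOdd h ≡ true
  isOdd-true h 2∤h =
    dec-true (∣ h ∣ ℕ.% 2 ℕ.≟ 1) (odd%2 (∣ h ∣ ℕ.% 2) (m%n<n ∣ h ∣ 2) (2∤h ∘ ℕ.m%n≡0⇒n∣m ∣ h ∣ 2))
    where
    odd%2 : ∀ r → r ℕ.< 2 → r ≢ 0 → r ≡ 1
    odd%2 0 _ r≢0 = contradiction refl r≢0
    odd%2 1 _ _   = refl
    odd%2 (suc (suc _)) (ℕ.s≤s (ℕ.s≤s ())) _

  coprime-cancel-ℤ : ∀ {n x y} → Coprime n ∣ x ∣ → + n ℤ∣.∣ x ℤ.* y → + n ℤ∣.∣ y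
  coprime-cancel-ℤ {n} {x} {y} n⊥x n∣xy =
    ∣ᵤ⇒∣ (coprime-divisor n⊥x (subst (n ℕ.∣_) (ℤP.abs-* x y) (∣⇒∣ᵤ n∣xy)))

  ∣-*-scale : ∀ {m x} k → + m ℤ∣.∣ x → + (m ℕ.* k) ℤ∣.∣ x ℤ.* + k
  ∣-*-scale {m} {x} k m∣x = subst (ℤ∣._∣ x ℤ.* + k) (sym (ℤP.pos-* m k)) (*-monoˡ-∣ (+ k) m∣x)

  module _ (M : ℕ) (h : ℤ) (gcd≡1 : gcd ∣ h ∣ (M ℕ.* 6) ≡ 1) where

    common-divisor≡1 : ∀ {d} → d ∣ ∣ h ∣ → d ∣ M ℕ.* 6 → d ≡ 1
    common-divisor≡1 d∣h d∣6M = ℕ.∣1⇒≡1 (subst (_ ∣_) gcd≡1 (gcd-greatest d∣h d∣6M))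

    2∤h : ¬ 2 ∣ ∣ h ∣
    2∤h 2∣h = contradiction (common-divisor≡1 2∣h (ℕ.divides (M ℕ.* 3) (sym (ℕP.*-assoc M 3 2)))) λ ()

    3∤h : ¬ 3 ∣ ∣ h ∣
    3∤h 3∣h = contradiction (common-divisor≡1 3∣h (ℕ.divides (M ℕ.* 2) (sym (ℕP.*-assoc M 2 3)))) λ ()

    h≢0 : h ≢ 0ℤ
    h≢0 refl = contradiction (common-divisor≡1 (ℕ.divides 0 refl) (ℕ.divides M refl)) λ ()

    h⊥6M² : PrimeFactorsOddAndCoprime ∣ h ∣ (+ (M ℕ.* 6) ℤ.* + M)
    h⊥6M² {p} p-prime p∣h =
      (λ { refl → 2∤h p∣h }) ,
      (λ p∣6M² → ℕ.nonTrivial⇒≢1 {{prime⇒nonTrivial p-prime}} (common-divisor≡1 p∣h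
         ([ (λ p∣6M → p∣6M) , (λ p∣M → ℕ.∣-trans p∣M (ℕ.divides 6 (ℕP.*-comm M 6))) ]′
          (euclidsLemma (M ℕ.* 6) M p-prime (subst (p ∣_) (ℤP.abs-* (+ (M ℕ.* 6)) (+ M)) (∣⇒∣ᵤ p∣6M²))))))

    negInv-combination : ∀ {h₁ h₂ h₃ h₆} →
      IsNegInv h (M ℕ.* 6) h₁ → IsNegInv h (M ℕ.* 3) h₂ → IsNegInv h (M ℕ.* 2) h₃ → IsNegInv h M h₆ →
      + (M ℕ.* 6) ℤ∣.∣ h₁ ℤ.+ h₂ ℤ.* + 2 ℤ.+ h₃ ℤ.* + 3 ℤ.- h₆ ℤ.* + 6
    negInv-combination {h₁} {h₂} {h₃} {h₆} i₁ i₂ i₃ i₆ =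
      coprime-cancel-ℤ {x = h} (Coprimality.sym (gcd≡1⇒coprime gcd≡1))
        (subst (+ (M ℕ.* 6) ℤ∣.∣_) (combine h h₁ h₂ h₃ h₆) (∣m∣n⇒∣m-n (∣m∣n⇒∣m+n (∣m∣n⇒∣m+n d₁ d₂) d₃) d₆))
      where
      d₁ : + (M ℕ.* 6) ℤ∣.∣ h ℤ.* h₁ ℤ.+ 1ℤ
      d₁ = ∣ᵤ⇒∣ i₁
      d₂ : + (M ℕ.* 6) ℤ∣.∣ (h ℤ.* h₂ ℤ.+ 1ℤ) ℤ.* + 2
      d₂ = subst (λ m → + m ℤ∣.∣ (h ℤ.* h₂ ℤ.+ 1ℤ) ℤ.* + 2) (ℕP.*-assoc M 3 2)
                 (∣-*-scale 2 (∣ᵤ⇒∣ {+ (M ℕ.* 3)} {h ℤ.* h₂ ℤ.+ 1ℤ} i₂))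
      d₃ : + (M ℕ.* 6) ℤ∣.∣ (h ℤ.* h₃ ℤ.+ 1ℤ) ℤ.* + 3
      d₃ = subst (λ m → + m ℤ∣.∣ (h ℤ.* h₃ ℤ.+ 1ℤ) ℤ.* + 3) (ℕP.*-assoc M 2 3)
                 (∣-*-scale 3 (∣ᵤ⇒∣ {+ (M ℕ.* 2)} {h ℤ.* h₃ ℤ.+ 1ℤ} i₃))
      d₆ : + (M ℕ.* 6) ℤ∣.∣ (h ℤ.* h₆ ℤ.+ 1ℤ) ℤ.* + 6
      d₆ = ∣-*-scale 6 (∣ᵤ⇒∣ {+ M} {h ℤ.* h₆ ℤ.+ 1ℤ} i₆)
      -- the constants cancel because 1 + 2 + 3 − 6 = 0
      combine : ∀ h a b c d → (h ℤ.* a ℤ.+ 1ℤ) ℤ.+ (h ℤ.* b ℤ.+ 1ℤ) ℤ.* + 2 ℤ.+ (h ℤ.* c ℤ.+ 1ℤ) ℤ.* + 3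
                              ℤ.- (h ℤ.* d ℤ.+ 1ℤ) ℤ.* + 6
                            ≡ h ℤ.* (a ℤ.+ b ℤ.* + 2 ℤ.+ c ℤ.* + 3 ℤ.- d ℤ.* + 6)
      combine = ℤ-Solver.solve-∀

open import Data.Nat as ℕ using (ℕ)
open import Data.Nat.Divisibility using (_∣_)
open import Data.Nat.GCD using (gcd)
open import Data.Integer as ℤ using (ℤ; +_; ∣_∣)
open import Data.Rational as ℚ using (ℚ; _/_)

open import Data.Nat using (suc)
import Data.Nat.Properties as ℕP
import Data.Nat.Divisibility as ℕ
open import Data.Nat.DivMod using (m*n/n≡m)
import Data.Integer.Properties as ℤP
open import Data.Integer.Tactic.RingSolver as ℤ-Solver using ()
open import Relation.Binary.PropositionalEquality using (sym; trans; cong)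
open Kronecker using (kronecker-square-product)
open Angles using (signAngle-sum-even; ωAngle-sum)
open CoprimeToSix

product-of-negated-multiples : ∀ M →
  ℤ.- (+ (M ℕ.* 6)) ℤ.* ℤ.- (+ (M ℕ.* 3)) ℤ.* (ℤ.- (+ (M ℕ.* 2)) ℤ.* ℤ.- (+ M))
    ≡ (+ (M ℕ.* 6) ℤ.* + M) ℤ.* (+ (M ℕ.* 6) ℤ.* + M)
product-of-negated-multiples M =
  trans (cong₃ (λ a b c → ℤ.- a ℤ.* ℤ.- b ℤ.* (ℤ.- c ℤ.* ℤ.- (+ M))) (ℤP.pos-* M 6) (ℤP.pos-* M 3) (ℤP.pos-* M 2))
        (trans (square (+ M)) (cong (λ a → (a ℤ.* + M) ℤ.* (a ℤ.* + M)) (sym (ℤP.pos-* M 6))))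
  where
  square : ∀ m → ℤ.- (m ℤ.* + 6) ℤ.* ℤ.- (m ℤ.* + 3) ℤ.* (ℤ.- (m ℤ.* + 2) ℤ.* ℤ.- m)
                   ≡ (m ℤ.* + 6 ℤ.* m) ℤ.* (m ℤ.* + 6 ℤ.* m)
  square = ℤ-Solver.solve-∀

m*6/d≡m*e : ∀ M d e .{{_ : ℕ.NonZero d}} → d ℕ.* e ≡ 6 → M ℕ.* 6 ℕ./ d ≡ M ℕ.* e
m*6/d≡m*e M d e de≡6 = trans (cong (ℕ._/ d) M*6≡M*e*d) (m*n/n≡m (M ℕ.* e) d)
  where
  M*6≡M*e*d : M ℕ.* 6 ≡ M ℕ.* e ℕ.* d
  M*6≡M*e*d = trans (cong (M ℕ.*_) (trans (sym de≡6) (ℕP.*-comm d e))) (sym (ℕP.*-assoc M e d))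

lemma3p2 : (k : ℕ) → ℕ.NonZero k → 6 ∣ k → (h : ℤ) → gcd ∣ h ∣ k ≡ 1 →
    (h₁ h₂ h₃ h₆ : ℤ) →
    IsNegInv h k h₁ → IsNegInv h (k ℕ./ 2) h₂ →
    IsNegInv h (k ℕ./ 3) h₃ → IsNegInv h (k ℕ./ 6) h₆ →
    (ωAngle h k h₁ ℚ.+ ωAngle h (k ℕ./ 2) h₂ ℚ.+ ωAngle h (k ℕ./ 3) h₃
      ℚ.- ωAngle h (k ℕ./ 6) h₆)
    ≡[mod2] (ℚ.1ℚ ℚ.+ ((+ 5 ℤ.* + k ℤ.+ + 18) ℤ.* h) / 36)
lemma3p2 .(M ℕ.* 6) _ (ℕ.divides M@(suc M′) refl) h gcd≡1 h₁ h₂ h₃ h₆ i₁ i₂ i₃ i₆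
  rewrite m*6/d≡m*e M 2 3 refl | m*6/d≡m*e M 3 2 refl | m*n/n≡m M 6 {{_}} =
  ωAngle-sum M′ h h₁ h₂ h₃ h₆
    (isOdd-true h (2∤h M h gcd≡1))
    (square-mod-24-ℤ h (2∤h M h gcd≡1) (3∤h M h gcd≡1))
    (negInv-combination M h gcd≡1 i₁ i₂ i₃ i₆)
    (signAngle-sum-even
      (kronecker-square-product (h≢0 M h gcd≡1) (h⊥6M² M h gcd≡1) _ _ _ _ (product-of-negated-multiples M)))
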